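{- For every integer $k\ge1$, let $$q_k(x)=\sum_{i=0}^k(-1)^i\binom{k}{i}x^{ki}-x^{k(k+1)}.$$ Then $$q_k(x)=(1-x^k-x^{k+1})\sum_{i=0}^{k-1}\sum_{j=0}^{i}(-1)^{i-j}\binom{k-1-j}{i-j}x^{ki+j}.$$ In particular, $1-x^k-x^{k+1}$ divides $q_k(x)$. -}

module Defs where

open import Algebra.Bundles using (CommutativeRing; Semiring)
open import Data.Nat.Base as ℕ using (ℕ; zero; suc; _∸_)
open import Data.Nat.Combinatorics using (_C_)

module _ {c ℓ} (R : CommutativeRing c ℓ) where
  open CommutativeRing R
  open import Algebra.Definitions.RawSemiring (Semiring.rawSemiring semiring) using (_×_; _^_)

  Σ< : ℕ → (ℕ → Carrier) → Carrier
  Σ< zero    f = 0#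
  Σ< (suc n) f = Σ< n f + f n

  sgn : ℕ → Carrier
  sgn zero    = 1#
  sgn (suc n) = - sgn n

  q : ℕ → Carrier → Carrier
  q k x = Σ< (suc k) (λ i → sgn i * ((k C i) × (x ^ (k ℕ.* i))))
          - x ^ (k ℕ.* (k ℕ.+ 1))

  trinom : ℕ → Carrier → Carrier
  trinom k x = 1# - x ^ k - x ^ (k ℕ.+ 1)

  cofactor : ℕ → Carrier → Carrier
  cofactor k x = Σ< k (λ i → Σ< (suc i) (λ j →
    sgn (i ∸ j) * ((((k ∸ 1) ∸ j) C (i ∸ j)) × (x ^ (k ℕ.* i ℕ.+ j)))))

-- With a = 1 - x^k and b = x^(k+1), the binomial theorem gives q_k(x) = a^k - b^k, and
-- 1 - x^k - x^(k+1) = a - b.  Exchanging the order of the double sum and applying the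
-- binomial theorem once more, the inner sums of the cofactor collapse to b^j a^(k-1-j), so
-- the cofactor is the complete homogeneous sum Σ_{j<k} b^j a^(k-1-j) = (a^k - b^k)/(a - b).
module Submission where

open import Algebra.Bundles using (CommutativeRing; Semiring)
open import Data.Nat.Base as ℕ using (ℕ; zero; suc; _∸_; _≤_; _<_)
import Data.Nat.Properties as ℕₚ
open import Data.Nat.Combinatorics using (_C_)
open import Data.Nat.Solver using (module +-*-Solver)
open import Data.Fin.Base using (toℕ)
import Relation.Binary.PropositionalEquality as ≡
open import Defs

module _ {c ℓ} (R : CommutativeRing c ℓ) where
  open CommutativeRing R
  open import Algebra.Definitions.RawSemiring (Semiring.rawSemiring semiring) using (_×_; _^_; sum)
  open import Algebra.Properties.Semiring.Exp semiring using (^-homo-*; ^-assocʳ; ^-congʳ; ^-congˡ)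
  open import Algebra.Properties.Semiring.Mult semiring using (×-comm-*; ×-congʳ)
  open import Algebra.Properties.Ring ring using (-‿distribˡ-*; x[y-z]≈xy-xz; [y-z]x≈yx-zx)
  open import Algebra.Properties.CommutativeSemigroup +-commutativeSemigroup using (interchange)
  open import Algebra.Properties.CommutativeSemigroup *-commutativeSemigroup using (x∙yz≈y∙xz)
  import Algebra.Properties.CommutativeSemiring.Binomial commutativeSemiring as Binomial
  open import Relation.Binary.Reasoning.Setoid setoid

  private
    Σ : ℕ → (ℕ → Carrier) → Carrier
    Σ = Σ< R

  Σ<-cong : ∀ n {f g : ℕ → Carrier} → (∀ i → i < n → f i ≈ g i) → Σ n f ≈ Σ n g
  Σ<-cong zero    f≈g = refl
  Σ<-cong (suc n) f≈g =
    +-cong (Σ<-cong n (λ i i<n → f≈g i (ℕₚ.m<n⇒m<1+n i<n))) (f≈g n (ℕₚ.n<1+n n))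

  Σ<-distrib-+ : ∀ n (f g : ℕ → Carrier) → Σ n (λ i → f i + g i) ≈ Σ n f + Σ n g
  Σ<-distrib-+ zero    f g = sym (+-identityˡ 0#)
  Σ<-distrib-+ (suc n) f g = trans (+-congʳ (Σ<-distrib-+ n f g)) (interchange _ _ _ _)

  *-distribˡ-Σ< : ∀ n a (f : ℕ → Carrier) → a * Σ n f ≈ Σ n (λ i → a * f i)
  *-distribˡ-Σ< zero    a f = zeroʳ a
  *-distribˡ-Σ< (suc n) a f = trans (distribˡ _ _ _) (+-congʳ (*-distribˡ-Σ< n a f))

  Σ<-suc : ∀ n (f : ℕ → Carrier) → Σ (suc n) f ≈ f 0 + Σ n (λ i → f (suc i))
  Σ<-suc zero    f = +-comm _ _
  Σ<-suc (suc n) f = trans (+-congʳ (Σ<-suc n f)) (+-assoc _ _ _)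

  sum≈Σ< : ∀ n (f : ℕ → Carrier) → sum {n} (λ i → f (toℕ i)) ≈ Σ n f
  sum≈Σ< zero    f = refl
  sum≈Σ< (suc n) f = trans (+-congˡ (sum≈Σ< n (λ i → f (suc i)))) (sym (Σ<-suc n f))

  Σ<-triangle : ∀ n (g : ℕ → ℕ → Carrier) →
    Σ n (λ i → Σ (suc i) (g i)) ≈ Σ n (λ j → Σ (n ∸ j) (λ t → g (j ℕ.+ t) j))
  Σ<-triangle zero    g = refl
  Σ<-triangle (suc n) g = begin
    Σ n (λ i → Σ (suc i) (g i)) + (Σ n (g n) + g n n)  ≈⟨ +-congʳ (Σ<-triangle n g) ⟩
    Σ n column + (Σ n (g n) + g n n)                  ≈⟨ sym (+-assoc _ _ _) ⟩
    (Σ n column + Σ n (g n)) + g n n                  ≈⟨ +-congʳ (sym (Σ<-distrib-+ n column (g n))) ⟩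
    Σ n (λ j → column j + g n j) + g n n              ≈⟨ +-cong (Σ<-cong n extend) corner ⟩
    Σ n (λ j → Σ (suc n ∸ j) (λ t → g (j ℕ.+ t) j)) + Σ (suc n ∸ n) (λ t → g (n ℕ.+ t) n) ∎
    where
    column : ℕ → Carrier
    column j = Σ (n ∸ j) (λ t → g (j ℕ.+ t) j)

    extend : ∀ j → j < n → column j + g n j ≈ Σ (suc n ∸ j) (λ t → g (j ℕ.+ t) j)
    extend j j<n rewrite ℕₚ.+-∸-assoc 1 (ℕₚ.<⇒≤ j<n) =
      +-congˡ (reflexive (≡.cong (λ i → g i j) (≡.sym (ℕₚ.m+[n∸m]≡n (ℕₚ.<⇒≤ j<n)))))

    corner : g n n ≈ Σ (suc n ∸ n) (λ t → g (n ℕ.+ t) n)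
    corner rewrite ℕₚ.m+n∸n≡m 1 n | ℕₚ.+-identityʳ n = sym (+-identityˡ _)

  [-x]^n≈sgn[n]*x^n : ∀ x n → (- x) ^ n ≈ sgn R n * x ^ n
  [-x]^n≈sgn[n]*x^n x zero    = sym (*-identityˡ _)
  [-x]^n≈sgn[n]*x^n x (suc n) = begin
    - x * (- x) ^ n              ≈⟨ *-congˡ ([-x]^n≈sgn[n]*x^n x n) ⟩
    - x * (sgn R n * x ^ n)      ≈⟨ sym (-‿distribˡ-* _ _) ⟩
    - (x * (sgn R n * x ^ n))    ≈⟨ -‿cong (x∙yz≈y∙xz _ _ _) ⟩
    - (sgn R n * (x * x ^ n))    ≈⟨ -‿distribˡ-* _ _ ⟩
    - sgn R n * (x * x ^ n)      ∎

  1^n≈1 : ∀ n → 1# ^ n ≈ 1#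
  1^n≈1 zero    = refl
  1^n≈1 (suc n) = trans (*-identityˡ _) (1^n≈1 n)

  alternating-binomial : ∀ n y → Σ (suc n) (λ t → sgn R t * ((n C t) × y ^ t)) ≈ (1# - y) ^ n
  alternating-binomial n y = sym (begin
    (1# - y) ^ n                                ≈⟨ ^-congˡ n (+-comm _ _) ⟩
    (- y + 1#) ^ n                              ≈⟨ Binomial.theorem n (- y) 1# ⟩
    sum {suc n} (λ t → expansionTerm (toℕ t))   ≈⟨ sum≈Σ< (suc n) expansionTerm ⟩
    Σ (suc n) expansionTerm                     ≈⟨ Σ<-cong (suc n) (λ t _ → signed t) ⟩
    Σ (suc n) (λ t → sgn R t * ((n C t) × y ^ t)) ∎)
    where
    expansionTerm : ℕ → Carrier
    expansionTerm t = (n C t) × ((- y) ^ t * 1# ^ (n ∸ t))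

    signed : ∀ t → expansionTerm t ≈ sgn R t * ((n C t) × y ^ t)
    signed t = begin
      (n C t) × ((- y) ^ t * 1# ^ (n ∸ t))  ≈⟨ ×-congʳ (n C t) (*-congˡ (1^n≈1 (n ∸ t))) ⟩
      (n C t) × ((- y) ^ t * 1#)            ≈⟨ ×-congʳ (n C t) (*-identityʳ _) ⟩
      (n C t) × (- y) ^ t                   ≈⟨ ×-congʳ (n C t) ([-x]^n≈sgn[n]*x^n y t) ⟩
      (n C t) × (sgn R t * y ^ t)           ≈⟨ sym (×-comm-* (n C t) _ _) ⟩
      sgn R t * ((n C t) × y ^ t)           ∎

  homogeneous : Carrier → Carrier → ℕ → Carrier
  homogeneous a b m = Σ (suc m) (λ j → b ^ j * a ^ (m ∸ j))

  homogeneous-suc : ∀ a b m → homogeneous a b (suc m) ≈ a * homogeneous a b m + b ^ suc m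
  homogeneous-suc a b m = +-cong
    (trans (Σ<-cong (suc m) (λ j j<1+m → shift j (ℕₚ.≤-pred j<1+m)))
           (sym (*-distribˡ-Σ< (suc m) a _)))
    (trans (*-congˡ (^-congʳ a (ℕₚ.n∸n≡0 m))) (*-identityʳ _))
    where
    shift : ∀ j → j ≤ m → b ^ j * a ^ (suc m ∸ j) ≈ a * (b ^ j * a ^ (m ∸ j))
    shift j j≤m rewrite ℕₚ.+-∸-assoc 1 j≤m = x∙yz≈y∙xz _ _ _

  [x-y]+[y-z]≈x-z : ∀ x y z → (x - y) + (y - z) ≈ x - z
  [x-y]+[y-z]≈x-z x y z = begin
    (x - y) + (y - z)  ≈⟨ +-assoc _ _ _ ⟩
    x + (- y + (y - z)) ≈⟨ +-congˡ (sym (+-assoc _ _ _)) ⟩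
    x + ((- y + y) - z) ≈⟨ +-congˡ (+-congʳ (-‿inverseˡ y)) ⟩
    x + (0# - z)        ≈⟨ +-congˡ (+-identityˡ _) ⟩
    x - z               ∎

  ^-difference : ∀ a b m → a ^ suc m - b ^ suc m ≈ (a - b) * homogeneous a b m
  ^-difference a b zero = begin
    a * 1# - b * 1#          ≈⟨ sym ([y-z]x≈yx-zx 1# a b) ⟩
    (a - b) * 1#             ≈⟨ *-congˡ (sym (trans (+-identityˡ _) (*-identityˡ _))) ⟩
    (a - b) * (0# + 1# * 1#) ∎
  ^-difference a b (suc m) = sym (begin
    (a - b) * homogeneous a b (suc m)          ≈⟨ *-congˡ (homogeneous-suc a b m) ⟩
    (a - b) * (a * homogeneous a b m + B)      ≈⟨ distribˡ _ _ _ ⟩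
    (a - b) * (a * homogeneous a b m) + (a - b) * B  ≈⟨ +-congʳ (x∙yz≈y∙xz _ _ _) ⟩
    a * ((a - b) * homogeneous a b m) + (a - b) * B  ≈⟨ +-congʳ (*-congˡ (sym (^-difference a b m))) ⟩
    a * (A - B) + (a - b) * B                  ≈⟨ +-cong (x[y-z]≈xy-xz a A B) ([y-z]x≈yx-zx B a b) ⟩
    (a * A - a * B) + (a * B - b * B)          ≈⟨ [x-y]+[y-z]≈x-z _ _ _ ⟩
    a * A - b * B                              ∎)
    where
    A = a ^ suc m
    B = b ^ suc m

  q≈[1-x^k]^k-[x^[k+1]]^k : ∀ k x → q R k x ≈ (1# - x ^ k) ^ k - (x ^ (k ℕ.+ 1)) ^ k
  q≈[1-x^k]^k-[x^[k+1]]^k k x = +-cong binomialPart (-‿cong lastPart)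
    where
    binomialPart : Σ (suc k) (λ i → sgn R i * ((k C i) × x ^ (k ℕ.* i))) ≈ (1# - x ^ k) ^ k
    binomialPart = trans
      (Σ<-cong (suc k) (λ i _ → *-congˡ (×-congʳ (k C i) (sym (^-assocʳ x k i)))))
      (alternating-binomial k (x ^ k))

    lastPart : x ^ (k ℕ.* (k ℕ.+ 1)) ≈ (x ^ (k ℕ.+ 1)) ^ k
    lastPart = trans (^-congʳ x (ℕₚ.*-comm k (k ℕ.+ 1))) (sym (^-assocʳ x (k ℕ.+ 1) k))

  cofactor≈homogeneous : ∀ m x →
    cofactor R (suc m) x ≈ homogeneous (1# - x ^ suc m) (x ^ (suc m ℕ.+ 1)) m
  cofactor≈homogeneous m x =
    trans (Σ<-triangle k term) (Σ<-cong k (λ j j<k → column j (ℕₚ.≤-pred j<k)))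
    where
    k = suc m
    a = 1# - x ^ k
    b = x ^ (k ℕ.+ 1)

    term : ℕ → ℕ → Carrier
    term i j = sgn R (i ∸ j) * (((m ∸ j) C (i ∸ j)) × x ^ (k ℕ.* i ℕ.+ j))

    exponent : ∀ j t → k ℕ.* (j ℕ.+ t) ℕ.+ j ≡.≡ (k ℕ.+ 1) ℕ.* j ℕ.+ k ℕ.* t
    exponent = solve 3 (λ k j t → k :* (j :+ t) :+ j := (k :+ con 1) :* j :+ k :* t) ≡.refl k
      where open +-*-Solver

    x-power : ∀ j t → x ^ (k ℕ.* (j ℕ.+ t) ℕ.+ j) ≈ b ^ j * (x ^ k) ^ t
    x-power j t = begin
      x ^ (k ℕ.* (j ℕ.+ t) ℕ.+ j)          ≈⟨ ^-congʳ x (exponent j t) ⟩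
      x ^ ((k ℕ.+ 1) ℕ.* j ℕ.+ k ℕ.* t)    ≈⟨ ^-homo-* x ((k ℕ.+ 1) ℕ.* j) (k ℕ.* t) ⟩
      x ^ ((k ℕ.+ 1) ℕ.* j) * x ^ (k ℕ.* t)
        ≈⟨ sym (*-cong (^-assocʳ x (k ℕ.+ 1) j) (^-assocʳ x k t)) ⟩
      b ^ j * (x ^ k) ^ t                  ∎

    diagonal : ∀ j t → term (j ℕ.+ t) j ≈ b ^ j * (sgn R t * (((m ∸ j) C t) × (x ^ k) ^ t))
    diagonal j t rewrite ℕₚ.m+n∸m≡n j t = begin
      sgn R t * (((m ∸ j) C t) × x ^ (k ℕ.* (j ℕ.+ t) ℕ.+ j))
        ≈⟨ *-congˡ (×-congʳ ((m ∸ j) C t) (x-power j t)) ⟩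
      sgn R t * (((m ∸ j) C t) × (b ^ j * (x ^ k) ^ t))
        ≈⟨ *-congˡ (sym (×-comm-* ((m ∸ j) C t) _ _)) ⟩
      sgn R t * (b ^ j * (((m ∸ j) C t) × (x ^ k) ^ t))
        ≈⟨ x∙yz≈y∙xz _ _ _ ⟩
      b ^ j * (sgn R t * (((m ∸ j) C t) × (x ^ k) ^ t)) ∎

    column : ∀ j → j ≤ m → Σ (k ∸ j) (λ t → term (j ℕ.+ t) j) ≈ b ^ j * a ^ (m ∸ j)
    column j j≤m rewrite ℕₚ.+-∸-assoc 1 j≤m = begin
      Σ (suc (m ∸ j)) (λ t → term (j ℕ.+ t) j)
        ≈⟨ Σ<-cong (suc (m ∸ j)) (λ t _ → diagonal j t) ⟩
      Σ (suc (m ∸ j)) (λ t → b ^ j * (sgn R t * (((m ∸ j) C t) × (x ^ k) ^ t)))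
        ≈⟨ sym (*-distribˡ-Σ< (suc (m ∸ j)) _ _) ⟩
      b ^ j * Σ (suc (m ∸ j)) (λ t → sgn R t * (((m ∸ j) C t) × (x ^ k) ^ t))
        ≈⟨ *-congˡ (alternating-binomial (m ∸ j) (x ^ k)) ⟩
      b ^ j * a ^ (m ∸ j) ∎

lemma2p4 : ∀ {c ℓ} (R : CommutativeRing c ℓ) (k : ℕ) → 1 ≤ k →
    (x : CommutativeRing.Carrier R) →
    CommutativeRing._≈_ R (q R k x) (CommutativeRing._*_ R (trinom R k x) (cofactor R k x))
lemma2p4 R (suc m) _ x = begin
  q R k x                        ≈⟨ q≈[1-x^k]^k-[x^[k+1]]^k R k x ⟩
  a ^ k - b ^ k                  ≈⟨ ^-difference R a b m ⟩
  (a - b) * homogeneous R a b m  ≈⟨ *-congˡ (sym (cofactor≈homogeneous R m x)) ⟩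
  trinom R k x * cofactor R k x  ∎
  where
  open CommutativeRing R
  open import Algebra.Definitions.RawSemiring (Semiring.rawSemiring semiring) using (_^_)
  open import Relation.Binary.Reasoning.Setoid setoid
  k = suc m
  a = 1# - x ^ k
  b = x ^ (k ℕ.+ 1)
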